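{- Let $\omega\in\{0,1\}^{\mathbb N}$ and let $u,z$ be factors of $\omega$ with $|u|\geq|z|$. Suppose $z=ayb$ with $a,b\in\{0,1\}$ and $y$ a (possibly empty) word. Then \[|u|_{z}= \begin{cases} |u|_{ay}-S(ay ,u), & \text{if } ay\notin \mathcal{RS}_{\omega},\\ |u|_{yb}-P(yb,u), & \text{if } yb\notin \mathcal{LS}_{\omega},\\ |u|_{ay}-|u|_{ay(1-b)}-S(ay,u), & \text{if } ay\in \mathcal{RS}_{\omega},\\ |u|_{yb}-|u|_{(1-a)yb}-P(yb, u), & \text{if } yb\in \mathcal{LS}_{\omega}. \end{cases}\]
   Context: A factor of an infinite word $\omega=\omega_0\omega_1\cdots$ is a finite word $\omega_i\cdots\omega_{i+m-1}$. $|u|$ is the length of $u$ and $|u|_w$ the number of occurrences of $w$ as a factor of $u$. A factor $v$ of $\omega$ is right special (resp. left special) if both $v0$ and $v1$ (resp. $0v$ and $1v$) are factors of $\omega$; $\mathcal{RS}_\omega$ (resp. $\mathcal{LS}_\omega$) denotes the set of right (resp. left) special factors of $\omega$. For words $z,w$: $P(z,w)=1$ if $z$ is a prefix of $w$ and $0$ otherwise; $S(z,w)=1$ if $z$ is a suffix of $w$ and $0$ otherwise. For a letter $b\in\{0,1\}$, $1-b$ denotes the other letter. -}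

module Defs where

open import Data.Bool using (Bool; true; false; not; _∧_; if_then_else_)
open import Data.Bool.Properties using () renaming (_≟_ to _≟B_)
open import Data.Nat using (ℕ; zero; suc; _+_)
open import Data.List using (List; []; _∷_; reverse; length)
open import Data.Product using (∃; _×_)
open import Relation.Binary.PropositionalEquality using (_≡_)
open import Relation.Nullary using (does)

-- Letters: 0 = false, 1 = true.  Words: List Bool.
-- An infinite word ω ∈ {0,1}^ℕ.
InfWord : Set
InfWord = ℕ → Bool

slice : InfWord → ℕ → ℕ → List Bool
slice ω i zero    = []
slice ω i (suc m) = ω i ∷ slice ω (suc i) m

Factor : InfWord → List Bool → Set
Factor ω v = ∃ λ i → slice ω i (length v) ≡ v

RS : InfWord → List Bool → Set
RS ω v = Factor ω (v Data.List.∷ʳ false) × Factor ω (v Data.List.∷ʳ true)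

LS : InfWord → List Bool → Set
LS ω v = Factor ω (false ∷ v) × Factor ω (true ∷ v)

isPrefix : List Bool → List Bool → Bool
isPrefix []      w        = true
isPrefix (x ∷ z) []       = false
isPrefix (x ∷ z) (y ∷ w)  = does (x ≟B y) ∧ isPrefix z w

isSuffix : List Bool → List Bool → Bool
isSuffix z w = isPrefix (reverse z) (reverse w)

P : List Bool → List Bool → ℕ
P z w = if isPrefix z w then 1 else 0

S : List Bool → List Bool → ℕ
S z w = if isSuffix z w then 1 else 0

-- occ w u = |u|_w : number of positions i with w occurring in u starting at i
occ : List Bool → List Bool → ℕ
occ w []      = P w []
occ w (x ∷ u) = P w (x ∷ u) + occ w u

module Submission where

-- Lemma 3.1 expresses |u|_z, for z = ayb, through occurrences of the shorter
-- words ay and yb.  The proof rests on two counting identities valid for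
-- every word w and every finite word u:
--
--   right extension:  |u|_w = |u|_{wb} + |u|_{w(1-b)} + S(w,u)
--   left extension:   |u|_w = |u|_{aw} + |u|_{(1-a)w} + P(w,u)
--
-- (an occurrence of w either extends by one letter, or sits at the very end,
-- resp. very beginning, of u).  Each is a sum over the positions of u of a
-- pointwise identity about prefixes; the right one also needs that the
-- positions where w ends u contribute exactly S(w,u).  Since every factor of a
-- factor of ω is a factor of ω, a word that is not a factor of ω occurs in no
-- factor u of ω; so if ay is not right special (resp. yb not left special) the
-- second term vanishes.  The four cases then follow by moving the remaining
-- terms to the other side in ℤ.

open import Defs
open import Data.Bool using (Bool; true; false; not; _∧_; _∨_; if_then_else_)
open import Data.Bool.Properties using () renaming (_≟_ to _≟B_)
open import Data.Nat using (ℕ; suc; _+_; _≤_; z≤n; s≤s)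
open import Data.Nat.Properties using (+-comm; +-identityʳ; 1+n≰n)
open import Data.Nat.Solver using (module +-*-Solver)
open import Data.List using (List; []; _∷_; _∷ʳ_; length; reverse)
open import Data.List.Properties
  using (≡-dec; unfold-reverse; reverse-injective; length-++; ∷-injectiveˡ; ∷-injectiveʳ)
open import Data.Integer using (+_; _-_) renaming (_+_ to _+ℤ_; -_ to negate)
import Data.Integer.Properties as ℤ
open import Data.Product using (_×_; _,_)
open import Data.Empty using (⊥; ⊥-elim)
open import Function using (_∘_)
open import Relation.Binary.Definitions using (DecidableEquality)
open import Relation.Binary.PropositionalEquality
open import Relation.Nullary using (¬_; does; yes; no)
open import Relation.Nullary.Decidable using (dec-true; dec-false)

open +-*-Solver using (solve; _:+_; _:=_)
open ≡-Reasoning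

𝟙 : Bool → ℕ
𝟙 c = if c then 1 else 0

infix 4 _≟W_
_≟W_ : DecidableEquality (List Bool)
_≟W_ = ≡-dec _≟B_

δ : List Bool → List Bool → ℕ
δ w v = 𝟙 (does (w ≟W v))

𝟙-disjoint-∨ : ∀ A B → (A ≡ true → B ≡ true → ⊥) → 𝟙 (A ∨ B) ≡ 𝟙 B + 𝟙 A
𝟙-disjoint-∨ false false _ = refl
𝟙-disjoint-∨ false true  _ = refl
𝟙-disjoint-∨ true  false _ = refl
𝟙-disjoint-∨ true  true  incompatible = ⊥-elim (incompatible refl refl)

does-≟-reverse : ∀ p q → does (reverse p ≟W reverse q) ≡ does (p ≟W q)
does-≟-reverse p q with p ≟W q
... | yes refl = dec-true (reverse p ≟W reverse p) refl
... | no p≢q   = dec-false (reverse p ≟W reverse q) (p≢q ∘ reverse-injective)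

isPrefix-length : ∀ p q → isPrefix p q ≡ true → length p ≤ length q
isPrefix-length []      q       _ = z≤n
isPrefix-length (c ∷ p) (d ∷ q) e with c ≟B d
... | yes _ = s≤s (isPrefix-length p q e)

isPrefix-[] : ∀ p → isPrefix p [] ≡ does (p ≟W [])
isPrefix-[] []      = refl
isPrefix-[] (_ ∷ _) = refl

isPrefix-∷ʳ : ∀ p q x → isPrefix p (q ∷ʳ x) ≡ isPrefix p q ∨ does (p ≟W q ∷ʳ x)
isPrefix-∷ʳ []      q       x = refl
isPrefix-∷ʳ (c ∷ p) []      x = cong (does (c ≟B x) ∧_) (isPrefix-[] p)
isPrefix-∷ʳ (c ∷ p) (d ∷ q) x with c ≟B d
... | yes _ = isPrefix-∷ʳ p q x
... | no  _ = refl

P-right-split : ∀ w v b → P w v ≡ P (w ∷ʳ b) v + P (w ∷ʳ not b) v + δ w v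
P-right-split []      []          b     = refl
P-right-split []      (false ∷ v) false = refl
P-right-split []      (false ∷ v) true  = refl
P-right-split []      (true ∷ v)  false = refl
P-right-split []      (true ∷ v)  true  = refl
P-right-split (c ∷ w) []          b     = refl
P-right-split (c ∷ w) (x ∷ v)     b with c ≟B x
... | yes _ = P-right-split w v b
... | no  _ = refl

P-left-shift : ∀ a x w v → P (a ∷ w) (x ∷ v) + P (not a ∷ w) (x ∷ v) ≡ P w v
P-left-shift false false w v = +-identityʳ (P w v)
P-left-shift false true  w v = refl
P-left-shift true  false w v = refl
P-left-shift true  true  w v = +-identityʳ (P w v)

S-[] : ∀ w → S w [] ≡ δ w []
S-[] w = cong 𝟙 (trans (isPrefix-[] (reverse w)) (does-≟-reverse w []))

S-∷ : ∀ w x u → S w (x ∷ u) ≡ δ w (x ∷ u) + S w u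
S-∷ w x u = begin
  𝟙 (isPrefix rw (reverse (x ∷ u)))          ≡⟨ cong (λ t → 𝟙 (isPrefix rw t)) (unfold-reverse x u) ⟩
  𝟙 (isPrefix rw (ru ∷ʳ x))                  ≡⟨ cong 𝟙 (isPrefix-∷ʳ rw ru x) ⟩
  𝟙 (isPrefix rw ru ∨ does (rw ≟W ru ∷ʳ x))  ≡⟨ 𝟙-disjoint-∨ _ _ too-long ⟩
  𝟙 (does (rw ≟W ru ∷ʳ x)) + S w u           ≡⟨ cong (λ t → 𝟙 t + S w u) equal-reversed ⟩
  δ w (x ∷ u) + S w u                        ∎
  where
  rw ru : List Bool
  rw = reverse w
  ru = reverse u
  equal-reversed : does (rw ≟W ru ∷ʳ x) ≡ does (w ≟W x ∷ u)
  equal-reversed = trans (cong (λ t → does (rw ≟W t)) (sym (unfold-reverse x u)))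
                         (does-≟-reverse w (x ∷ u))
  too-long : isPrefix rw ru ≡ true → does (rw ≟W ru ∷ʳ x) ≡ true → ⊥
  too-long prefix _ with rw ≟W ru ∷ʳ x
  ... | yes rw≡rux = 1+n≰n (subst (_≤ length ru) length-rw (isPrefix-length rw ru prefix))
    where
    length-rw : length rw ≡ suc (length ru)
    length-rw = trans (cong length rw≡rux) (trans (length-++ ru) (+-comm (length ru) 1))

occ-right-extension : ∀ w u b → occ w u ≡ occ (w ∷ʳ b) u + occ (w ∷ʳ not b) u + S w u
occ-right-extension w []      b = trans (P-right-split w [] b)
  (cong (λ t → P (w ∷ʳ b) [] + P (w ∷ʳ not b) [] + t) (sym (S-[] w)))
occ-right-extension w (x ∷ u) b = begin
  P w xu + occ w u
    ≡⟨ cong₂ _+_ (P-right-split w xu b) (occ-right-extension w u b) ⟩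
  (P wb xu + P wb̄ xu + δ w xu) + (occ wb u + occ wb̄ u + S w u)
    ≡⟨ regroup (P wb xu) (P wb̄ xu) (δ w xu) (occ wb u) (occ wb̄ u) (S w u) ⟩
  occ wb xu + occ wb̄ xu + (δ w xu + S w u)
    ≡⟨ cong (λ t → occ wb xu + occ wb̄ xu + t) (sym (S-∷ w x u)) ⟩
  occ wb xu + occ wb̄ xu + S w xu ∎
  where
  xu wb wb̄ : List Bool
  xu = x ∷ u
  wb = w ∷ʳ b
  wb̄ = w ∷ʳ not b
  regroup : ∀ p₁ p₂ e o₁ o₂ s → (p₁ + p₂ + e) + (o₁ + o₂ + s) ≡ (p₁ + o₁) + (p₂ + o₂) + (e + s)
  regroup = solve 6 (λ p₁ p₂ e o₁ o₂ s →
    (p₁ :+ p₂ :+ e) :+ (o₁ :+ o₂ :+ s) := (p₁ :+ o₁) :+ (p₂ :+ o₂) :+ (e :+ s)) refl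

occ-left-extension : ∀ a w u → occ w u ≡ occ (a ∷ w) u + occ (not a ∷ w) u + P w u
occ-left-extension a w []      = refl
occ-left-extension a w (x ∷ u) = begin
  P w xu + occ w u
    ≡⟨ cong (_+_ (P w xu)) (occ-left-extension a w u) ⟩
  P w xu + (occ aw u + occ āw u + P w u)
    ≡⟨ cong (λ t → P w xu + (occ aw u + occ āw u + t)) (sym (P-left-shift a x w u)) ⟩
  P w xu + (occ aw u + occ āw u + (P aw xu + P āw xu))
    ≡⟨ regroup (P w xu) (occ aw u) (occ āw u) (P aw xu) (P āw xu) ⟩
  occ aw xu + occ āw xu + P w xu ∎
  where
  xu aw āw : List Bool
  xu = x ∷ u
  aw = a ∷ w
  āw = not a ∷ w
  regroup : ∀ p o₁ o₂ q₁ q₂ → p + (o₁ + o₂ + (q₁ + q₂)) ≡ (q₁ + o₁) + (q₂ + o₂) + p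
  regroup = solve 5 (λ p o₁ o₂ q₁ q₂ →
    p :+ (o₁ :+ o₂ :+ (q₁ :+ q₂)) := (q₁ :+ o₁) :+ (q₂ :+ o₂) :+ p) refl

prefix-of-slice : ∀ (ω : InfWord) i w v →
  isPrefix w v ≡ true → slice ω i (length v) ≡ v → slice ω i (length w) ≡ w
prefix-of-slice ω i []      v       _ _ = refl
prefix-of-slice ω i (c ∷ w) (d ∷ v) e s with c ≟B d
... | yes refl = cong₂ _∷_ (∷-injectiveˡ s) (prefix-of-slice ω (suc i) w v e (∷-injectiveʳ s))

occ-non-factor : ∀ (ω : InfWord) i w u →
  ¬ Factor ω w → slice ω i (length u) ≡ u → occ w u ≡ 0
occ-non-factor ω i w u absent = occ-absent u i
  where
  P-absent : ∀ i v → slice ω i (length v) ≡ v → P w v ≡ 0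
  P-absent i v s with isPrefix w v in e
  ... | true  = ⊥-elim (absent (i , prefix-of-slice ω i w v e s))
  ... | false = refl
  occ-absent : ∀ u i → slice ω i (length u) ≡ u → occ w u ≡ 0
  occ-absent []      i s = P-absent i [] s
  occ-absent (x ∷ u) i s = cong₂ _+_ (P-absent i (x ∷ u) s) (occ-absent u (suc i) (∷-injectiveʳ s))

other-right-extension-absent : ∀ ω v b → ¬ RS ω v → Factor ω (v ∷ʳ b) → ¬ Factor ω (v ∷ʳ not b)
other-right-extension-absent ω v false not-rs f g = not-rs (f , g)
other-right-extension-absent ω v true  not-rs f g = not-rs (g , f)

other-left-extension-absent : ∀ ω v a → ¬ LS ω v → Factor ω (a ∷ v) → ¬ Factor ω (not a ∷ v)
other-left-extension-absent ω v false not-ls f g = not-ls (f , g)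
other-left-extension-absent ω v true  not-ls f g = not-ls (g , f)

occ-non-right-special : ∀ ω i v u b → ¬ RS ω v → Factor ω (v ∷ʳ b) →
  slice ω i (length u) ≡ u → occ v u ≡ occ (v ∷ʳ b) u + S v u
occ-non-right-special ω i v u b not-rs vb-factor u-at-i = begin
  occ v u                                   ≡⟨ occ-right-extension v u b ⟩
  occ (v ∷ʳ b) u + occ (v ∷ʳ not b) u + S v u
    ≡⟨ cong (λ t → occ (v ∷ʳ b) u + t + S v u) (occ-non-factor ω i _ u vb̄-absent u-at-i) ⟩
  occ (v ∷ʳ b) u + 0 + S v u                ≡⟨ cong (_+ S v u) (+-identityʳ (occ (v ∷ʳ b) u)) ⟩
  occ (v ∷ʳ b) u + S v u                    ∎
  where
  vb̄-absent : ¬ Factor ω (v ∷ʳ not b)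
  vb̄-absent = other-right-extension-absent ω v b not-rs vb-factor

occ-non-left-special : ∀ ω i v u a → ¬ LS ω v → Factor ω (a ∷ v) →
  slice ω i (length u) ≡ u → occ v u ≡ occ (a ∷ v) u + P v u
occ-non-left-special ω i v u a not-ls av-factor u-at-i = begin
  occ v u                                   ≡⟨ occ-left-extension a v u ⟩
  occ (a ∷ v) u + occ (not a ∷ v) u + P v u
    ≡⟨ cong (λ t → occ (a ∷ v) u + t + P v u) (occ-non-factor ω i _ u āv-absent u-at-i) ⟩
  occ (a ∷ v) u + 0 + P v u                 ≡⟨ cong (_+ P v u) (+-identityʳ (occ (a ∷ v) u)) ⟩
  occ (a ∷ v) u + P v u                     ∎
  where
  āv-absent : ¬ Factor ω (not a ∷ v)
  āv-absent = other-left-extension-absent ω v a not-ls av-factor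

sub-summand : ∀ {n m k} → n ≡ m + k → + n - + k ≡ + m
sub-summand {m = m} {k} refl = begin
  + (m + k) - + k      ≡⟨ cong (_- + k) (ℤ.pos-+ m k) ⟩
  + m +ℤ + k - + k     ≡⟨ ℤ.+-assoc (+ m) (+ k) (negate (+ k)) ⟩
  + m +ℤ (+ k - + k)   ≡⟨ cong (+ m +ℤ_) (ℤ.+-inverseʳ (+ k)) ⟩
  + m +ℤ + 0           ≡⟨ ℤ.+-identityʳ (+ m) ⟩
  + m                  ∎

sub-summands : ∀ {n m p k} → n ≡ m + p + k → + n - + p - + k ≡ + m
sub-summands {m = m} {p} {k} n≡ =
  trans (cong (_- + k) (sub-summand {m = m + k} (trans n≡ (swap m p k)))) (sub-summand {k = k} refl)
  where
  swap : ∀ m p k → m + p + k ≡ m + k + p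
  swap = solve 3 (λ m p k → m :+ p :+ k := m :+ k :+ p) refl

lemma3p1 : (ω : InfWord) (u : List Bool) (a : Bool) (y : List Bool) (b : Bool) →
    Factor ω u → Factor ω ((a ∷ y) ∷ʳ b) → length ((a ∷ y) ∷ʳ b) ≤ length u →
    (¬ RS ω (a ∷ y) →
       + occ ((a ∷ y) ∷ʳ b) u ≡ + occ (a ∷ y) u - + S (a ∷ y) u)
    × (¬ LS ω (y ∷ʳ b) →
       + occ ((a ∷ y) ∷ʳ b) u ≡ + occ (y ∷ʳ b) u - + P (y ∷ʳ b) u)
    × (RS ω (a ∷ y) →
       + occ ((a ∷ y) ∷ʳ b) u ≡ + occ (a ∷ y) u - + occ ((a ∷ y) ∷ʳ not b) u - + S (a ∷ y) u)
    × (LS ω (y ∷ʳ b) →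
       + occ ((a ∷ y) ∷ʳ b) u ≡ + occ (y ∷ʳ b) u - + occ ((not a ∷ y) ∷ʳ b) u - + P (y ∷ʳ b) u)
lemma3p1 ω u a y b (i , u-at-i) z-factor _ =
    (λ not-rs → sym (sub-summand (occ-non-right-special ω i (a ∷ y) u b not-rs z-factor u-at-i)))
  , (λ not-ls → sym (sub-summand (occ-non-left-special ω i (y ∷ʳ b) u a not-ls z-factor u-at-i)))
  , (λ _ → sym (sub-summands (occ-right-extension (a ∷ y) u b)))
  , (λ _ → sym (sub-summands (occ-left-extension a (y ∷ʳ b) u)))
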